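{- If $a,b,c$ are odd primes with $a^2+a+1=3(b^2+b+1)(c^2+c+1)$, then at least one of $b^2+b+1$ and $c^2+c+1$ is composite. -}

module Defs where

module Submission where

-- Write f(n) = n² + n + 1.  Suppose a, b, c are odd primes with
-- f(a) = 3 f(b) f(c) and, for a contradiction, f(b) and f(c) both prime.
--
-- The heart of the argument is a divisibility lemma about f alone
-- ('prime-value-divisor'): if a, b are odd, f(b) is prime and f(b) ∣ f(a),
-- then a = b, a = b², or a ≥ 2 f(b).  Since f is strictly increasing,
-- f(b) ∣ f(a) forces b ≤ a; writing a = b + d we have
--   f(a) = f(b) + d (a + b + 1),
-- so the prime f(b) divides d or a + b + 1.  Looking at the quotient,
-- the small cases give a = b, a = b², or make a even (a = (b + 1)² or
-- a + b + 1 = 2 f(b)); every larger quotient gives a ≥ 2 f(b).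
--
-- In the theorem a ≠ b (as f(b) < 3 f(b) f(c)) and a ≠ b² (a is prime),
-- and likewise for c, so 2 f(b) ≤ a and 2 f(c) ≤ a.  Then
--   4 f(b) f(c) ≤ a² < f(a) = 3 f(b) f(c),
-- which is absurd.  Hence one of f(b), f(c) is not prime, i.e. composite
-- (only the oddness of b and c is used, not their primality).

open import Defs
open import Data.Nat using (ℕ; zero; suc; _+_; _*_; _^_; _≤_; _<_; z≤n; s≤s; NonZero; >-nonZero; n>1⇒nonTrivial)
open import Data.Nat.Properties
open import Data.Nat.Divisibility using (_∣_; divides; ∣m+n∣m⇒∣n; ∣-refl; ∣⇒≤; m∣m*n; n∣m*n; ∣-trans)
open import Data.Nat.Primality
  using (Prime; Composite; euclidsLemma; composite-≢; composite?; ¬composite⇒prime; prime⇒¬composite)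
open import Data.Nat.Tactic.RingSolver using (solve-∀)
open import Data.Product using (_,_)
open import Data.Sum using (_⊎_; inj₁; inj₂)
open import Data.Empty using (⊥; ⊥-elim)
open import Relation.Nullary using (¬_; yes; no; contradiction)
open import Relation.Binary.PropositionalEquality using (_≡_; _≢_; refl; sym; trans; cong; subst)

f : ℕ → ℕ
f n = n ^ 2 + n + 1

parity : ∀ n → 2 ∣ n ⊎ 2 ∣ suc n
parity zero = inj₁ (divides 0 refl)
parity (suc n) with parity n
... | inj₁ (divides q n≡2q) = inj₂ (divides (suc q) (cong (2 +_) n≡2q))
... | inj₂ 2∣1+n = inj₁ 2∣1+n

odd⇒even-successor : ∀ {n} → ¬ 2 ∣ n → 2 ∣ suc n
odd⇒even-successor {n} n-odd with parity n
... | inj₁ 2∣n = contradiction 2∣n n-odd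
... | inj₂ 2∣1+n = 2∣1+n

square-not-prime : ∀ n → ¬ Prime (n ^ 2)
square-not-prime zero = λ ()
square-not-prime (suc zero) = λ ()
square-not-prime n@(suc (suc _)) n²-prime = prime⇒¬composite n²-prime
  (composite-≢ n (<⇒≢ (m<m*n n (n ^ 1) (s≤s (s≤s z≤n)))) (m∣m*n (n ^ 1)))

-- Elementary facts about f.  Polynomial identities are proved by the ring
-- solver on the unfolded form n ^ 2 = n * (n * 1), which it accepts.
f-split : ∀ n → f n ≡ n ^ 2 + suc n
f-split n = trans (+-assoc (n ^ 2) n 1) (cong (n ^ 2 +_) (+-comm n 1))

suc-n≤f : ∀ n → suc n ≤ f n
suc-n≤f n = subst (suc n ≤_) (sym (f-split n)) (m≤n+m (suc n) (n ^ 2))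

f-nonZero : ∀ n → NonZero (f n)
f-nonZero n = >-nonZero (≤-trans (s≤s z≤n) (suc-n≤f n))

f-increasing : ∀ {m n} → m < n → f m < f n
f-increasing {m} {n} m<n = +-monoˡ-< 1 (+-mono-≤-< (^-monoˡ-≤ 2 (<⇒≤ m<n)) m<n)

f-difference : ∀ b d → f (b + d) ≡ f b + d * ((b + d) + suc b)
f-difference = identity
  where
  identity : ∀ b d → (b + d) * ((b + d) * 1) + (b + d) + 1
                     ≡ (b * (b * 1) + b + 1) + d * ((b + d) + suc b)
  identity = solve-∀

-- b + f(b) = (b + 1)², which is even when b is odd.
f-completes-square : ∀ b → b + f b ≡ suc b ^ 2
f-completes-square = identity
  where
  identity : ∀ b → b + (b * (b * 1) + b + 1) ≡ suc b * (suc b * 1)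
  identity = solve-∀

-- First branch of the key lemma: f(b) divides d, where b + d is odd.
-- A quotient 1 would make b + d = (b + 1)² even, so d = 0 or d ≥ 2 f(b).
divisor-of-difference : ∀ b d → 2 ∣ suc b → ¬ 2 ∣ (b + d) → f b ∣ d →
                        d ≡ 0 ⊎ 2 * f b ≤ d
divisor-of-difference b d 2∣1+b a-odd (divides zero d≡0) = inj₁ d≡0
divisor-of-difference b d 2∣1+b a-odd (divides 1 d≡fb) =
  contradiction (subst (2 ∣_) [1+b]²≡a (∣-trans 2∣1+b (m∣m*n (suc b ^ 1)))) a-odd
  where
  [1+b]²≡a : suc b ^ 2 ≡ b + d
  [1+b]²≡a = sym (trans (cong (b +_) (trans d≡fb (+-identityʳ (f b)))) (f-completes-square b))
divisor-of-difference b d 2∣1+b a-odd (divides (suc (suc q)) d≡[2+q]fb) =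
  inj₂ (subst (2 * f b ≤_) (sym d≡[2+q]fb) (+-monoʳ-≤ (f b) (+-monoʳ-≤ (f b) z≤n)))

-- Second branch: f(b) divides a + b + 1, where a is odd and b + 1 even.
-- Quotient 1 means a = b², quotient 2 would make a even, and a quotient
-- q ≥ 3 gives a + b + 1 ≥ 3 f(b) ≥ 2 f(b) + b + 1.
divisor-of-sum : ∀ a b → 2 ∣ suc b → ¬ 2 ∣ a → f b ∣ a + suc b →
                 a ≡ b ^ 2 ⊎ 2 * f b ≤ a
divisor-of-sum a b 2∣1+b a-odd (divides zero sum≡0) = contradiction sum≡0 (m+1+n≢0 a)
divisor-of-sum a b 2∣1+b a-odd (divides 1 sum≡fb) =
  inj₁ (+-cancelʳ-≡ (suc b) a (b ^ 2) (trans sum≡fb (trans (+-identityʳ (f b)) (f-split b))))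
divisor-of-sum a b 2∣1+b a-odd (divides 2 sum≡2fb) =
  contradiction (∣m+n∣m⇒∣n (subst (2 ∣_) (+-comm a (suc b)) 2∣sum) 2∣1+b) a-odd
  where
  2∣sum : 2 ∣ a + suc b
  2∣sum = divides (f b) (trans sum≡2fb (*-comm 2 (f b)))
divisor-of-sum a b 2∣1+b a-odd (divides (suc (suc (suc q))) sum≡[3+q]fb) =
  inj₂ (+-cancelʳ-≤ (suc b) (2 * f b) a (begin
    2 * f b + suc b      ≤⟨ +-monoʳ-≤ (2 * f b) (suc-n≤f b) ⟩
    2 * f b + f b        ≡⟨ +-comm (2 * f b) (f b) ⟩
    3 * f b              ≤⟨ *-monoˡ-≤ (f b) (m≤m+n 3 q) ⟩
    (3 + q) * f b        ≡⟨ sym sum≡[3+q]fb ⟩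
    a + suc b            ∎))
  where open ≤-Reasoning

-- The key lemma for a = b + d: the prime f(b) divides
-- f(b + d) − f(b) = d (a + b + 1), so it divides one of the two factors.
prime-value-divisor-from : ∀ b d → ¬ 2 ∣ (b + d) → 2 ∣ suc b → Prime (f b) →
                           f b ∣ f (b + d) →
                           b + d ≡ b ⊎ b + d ≡ b ^ 2 ⊎ 2 * f b ≤ b + d
prime-value-divisor-from b d a-odd 2∣1+b fb-prime fb∣fa
  with euclidsLemma d ((b + d) + suc b) fb-prime
         (∣m+n∣m⇒∣n (subst (f b ∣_) (f-difference b d) fb∣fa) ∣-refl)
... | inj₂ fb∣sum = inj₂ (divisor-of-sum (b + d) b 2∣1+b a-odd fb∣sum)
... | inj₁ fb∣d with divisor-of-difference b d 2∣1+b a-odd fb∣d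
...   | inj₁ d≡0 = inj₁ (trans (cong (b +_) d≡0) (+-identityʳ b))
...   | inj₂ 2fb≤d = inj₂ (inj₂ (≤-trans 2fb≤d (m≤n+m d b)))

-- Key lemma: for odd a, b with f(b) prime and f(b) ∣ f(a), either
-- a = b, a = b², or a ≥ 2 f(b).  As f is increasing, a < b is impossible.
prime-value-divisor : ∀ a b → ¬ 2 ∣ a → ¬ 2 ∣ b → Prime (f b) → f b ∣ f a →
                      a ≡ b ⊎ a ≡ b ^ 2 ⊎ 2 * f b ≤ a
prime-value-divisor a b a-odd b-odd fb-prime fb∣fa with b ≤? a
... | no b≰a = contradiction (∣⇒≤ {{f-nonZero a}} fb∣fa) (<⇒≱ (f-increasing (≰⇒> b≰a)))
... | yes b≤a with m≤n⇒∃[o]m+o≡n b≤a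
...   | d , refl = prime-value-divisor-from b d a-odd (odd⇒even-successor b-odd) fb-prime fb∣fa

below-triple-product : ∀ x y .{{_ : NonZero x}} .{{_ : NonZero y}} → x < 3 * (x * y)
below-triple-product x y = begin-strict
  x          ≤⟨ m≤m*n x y ⟩
  x * y      <⟨ m<m*n (x * y) 3 {{m*n≢0 x y}} (s≤s (s≤s z≤n)) ⟩
  x * y * 3  ≡⟨ *-comm (x * y) 3 ⟩
  3 * (x * y) ∎
  where open ≤-Reasoning

doubled-factors-too-large : ∀ a x y → 2 * x ≤ a → 2 * y ≤ a → f a ≢ 3 * (x * y)
doubled-factors-too-large a x y 2x≤a 2y≤a fa≡3xy = <-irrefl refl (begin-strict
  f a               ≡⟨ fa≡3xy ⟩
  3 * (x * y)       ≤⟨ m≤m+n (3 * (x * y)) (x * y) ⟩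
  3 * (x * y) + x * y ≡⟨ four-times x y ⟩
  (2 * x) * (2 * y) ≤⟨ *-mono-≤ 2x≤a (subst (2 * y ≤_) (sym (*-identityʳ a)) 2y≤a) ⟩
  a ^ 2             ≤⟨ m≤m+n (a ^ 2) a ⟩
  a ^ 2 + a         <⟨ m<m+n (a ^ 2 + a) (s≤s z≤n) ⟩
  f a               ∎)
  where
  open ≤-Reasoning
  four-times : ∀ x y → 3 * (x * y) + x * y ≡ (2 * x) * (2 * y)
  four-times = solve-∀

prime-values-impossible : ∀ a b c → Prime a → ¬ 2 ∣ a → ¬ 2 ∣ b → ¬ 2 ∣ c →
                          f a ≡ 3 * (f b * f c) → Prime (f b) → Prime (f c) → ⊥
prime-values-impossible a b c a-prime a-odd b-odd c-odd fa≡3fbfc fb-prime fc-prime =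
  doubled-factors-too-large a (f b) (f c)
    (doubled-value-below b b-odd fb-prime fb∣fa fb<fa)
    (doubled-value-below c c-odd fc-prime fc∣fa fc<fa)
    fa≡3fbfc
  where
  -- A proper prime value f(n) dividing f(a) has 2 f(n) ≤ a: the other
  -- cases of the key lemma are a = n (excluded by f(n) < f(a)) and
  -- a = n² (excluded as a is prime).
  doubled-value-below : ∀ n → ¬ 2 ∣ n → Prime (f n) → f n ∣ f a → f n < f a → 2 * f n ≤ a
  doubled-value-below n n-odd fn-prime fn∣fa fn<fa
    with prime-value-divisor a n a-odd n-odd fn-prime fn∣fa
  ... | inj₁ refl = contradiction fn<fa (<-irrefl refl)
  ... | inj₂ (inj₁ refl) = contradiction a-prime (square-not-prime n)
  ... | inj₂ (inj₂ 2fn≤a) = 2fn≤a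

  fb∣fa : f b ∣ f a
  fb∣fa = subst (f b ∣_) (sym fa≡3fbfc) (∣-trans (m∣m*n (f c)) (n∣m*n 3))

  fc∣fa : f c ∣ f a
  fc∣fa = subst (f c ∣_) (sym fa≡3fbfc) (∣-trans (n∣m*n (f b)) (n∣m*n 3))

  fb<fa : f b < f a
  fb<fa = subst (f b <_) (sym fa≡3fbfc)
            (below-triple-product (f b) (f c) {{f-nonZero b}} {{f-nonZero c}})

  fc<fa : f c < f a
  fc<fa = subst (f c <_) (trans (cong (3 *_) (*-comm (f c) (f b))) (sym fa≡3fbfc))
            (below-triple-product (f c) (f b) {{f-nonZero c}} {{f-nonZero b}})

prime-or-composite-value : ∀ n → ¬ 2 ∣ n → Prime (f n) ⊎ Composite (f n)
prime-or-composite-value zero 0-odd = contradiction (divides 0 refl) 0-odd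
prime-or-composite-value n@(suc _) _ with composite? (f n)
... | yes fn-composite = inj₂ fn-composite
... | no fn-not-composite =
  inj₁ (¬composite⇒prime {{n>1⇒nonTrivial (≤-trans (s≤s (s≤s z≤n)) (suc-n≤f n))}} fn-not-composite)

lemma3 : (a b c : ℕ) → Prime a → ¬ (2 ∣ a) → Prime b → ¬ (2 ∣ b) → Prime c → ¬ (2 ∣ c)
    → a ^ 2 + a + 1 ≡ 3 * ((b ^ 2 + b + 1) * (c ^ 2 + c + 1))
    → Composite (b ^ 2 + b + 1) ⊎ Composite (c ^ 2 + c + 1)
lemma3 a b c a-prime a-odd _ b-odd _ c-odd fa≡3fbfc
  with prime-or-composite-value b b-odd | prime-or-composite-value c c-odd
... | inj₂ fb-composite | _ = inj₁ fb-composite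
... | inj₁ _ | inj₂ fc-composite = inj₂ fc-composite
... | inj₁ fb-prime | inj₁ fc-prime =
  ⊥-elim (prime-values-impossible a b c a-prime a-odd b-odd c-odd fa≡3fbfc fb-prime fc-prime)
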